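{- Let $\mathcal V$ be a homogeneous subspace of $\mathcal R_n^{(\ell)}$. Then $\mathcal E(\mathcal D(\mathcal V))=\mathcal D(\mathcal E(\mathcal V))$.
   Context: $\mathcal R_n^{(\ell)}=\mathbb K[x_{ij}:1\le i\le\ell,1\le j\le n]$ over a field $\mathbb K$ of characteristic $0$; a subspace is homogeneous if it has a basis of multihomogeneous polynomials (homogeneous in each row of variables). $\partial_{ij}=\partial/\partial x_{ij}$ and $E^{(p)}_{i,k}=\sum_{j=1}^nx_{ij}\,\partial^p/\partial x_{kj}^p$ ($1\le i,k\le\ell$, $p\ge1$). $\mathcal D(\mathcal V)$ is the smallest subspace containing $\mathcal V$ closed under all $\partial_{ij}$; $\mathcal E(\mathcal V)$ is the smallest subspace containing $\mathcal V$ closed under all $E^{(p)}_{i,k}$. -}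

module Defs where

open import Level using (Level; _⊔_) renaming (suc to lsuc)
open import Algebra.Bundles using (CommutativeRing)
open import Data.Nat as ℕ using (ℕ; zero; suc)
open import Data.Fin using (Fin)
open import Data.Vec as Vec using (Vec; lookup; _[_]%=_)
open import Data.Vec.Properties using (≡-dec)
open import Data.List as List using (List; []; _∷_; _++_; concatMap; allFin)
open import Data.List.Relation.Unary.All using (All)
open import Data.List.Relation.Unary.AllPairs using (AllPairs)
open import Data.Product using (_×_; _,_; proj₁; proj₂; ∃; Σ)
open import Relation.Nullary using (¬_; yes; no)
open import Relation.Binary.PropositionalEquality using (_≡_)

record Field (c ℓ : Level) : Set (lsuc (c ⊔ ℓ)) where
  field
    commutativeRing : CommutativeRing c ℓ
  open CommutativeRing commutativeRing public
  field
    1≉0     : ¬ (1# ≈ 0#)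
    inverse : ∀ x → ¬ (x ≈ 0#) → ∃ λ y → x * y ≈ 1#

module _ {c ℓ : Level} (K : Field c ℓ) where
  open Field K

  ℕ→K : ℕ → Carrier
  ℕ→K zero    = 0#
  ℕ→K (suc k) = 1# + ℕ→K k

  Char0 : Set ℓ
  Char0 = ∀ k → ¬ (ℕ→K (suc k) ≈ 0#)

-- Polynomials in R_n^(ℓ) = K[x_ij : i ∈ Fin l, j ∈ Fin n], represented as
-- finite formal sums of terms (coefficient, monomial); a monomial is its
-- exponent matrix (row i = exponents of x_i1 … x_in).  Two representations
-- denote the same polynomial iff all their coefficients agree (_≈P_).
module Poly {c ℓ : Level} (K : Field c ℓ) (l n : ℕ) where
  open Field K

  Mono : Set
  Mono = Vec (Vec ℕ n) l

  Term : Set c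
  Term = Carrier × Mono

  R : Set c
  R = List Term

  coeff : R → Mono → Carrier
  coeff []            m = 0#
  coeff ((a , m′) ∷ p) m with ≡-dec (≡-dec ℕ._≟_) m′ m
  ... | yes _ = a + coeff p m
  ... | no  _ = coeff p m

  infix 4 _≈P_
  _≈P_ : R → R → Set ℓ
  p ≈P q = ∀ m → coeff p m ≈ coeff q m

  0P : R
  0P = []

  _+P_ : R → R → R
  _+P_ = _++_

  _·P_ : Carrier → R → R
  a ·P p = List.map (λ t → a * proj₁ t , proj₂ t) p

  expo : Fin l → Fin n → Mono → ℕ
  expo i j m = lookup (lookup m i) j

  mulVar : Fin l → Fin n → R → R
  mulVar i j = List.map (λ t → proj₁ t , (proj₂ t [ i ]%= (_[ j ]%= suc)))

  ∂ : Fin l → Fin n → R → R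
  ∂ i j = List.map (λ t → ℕ→K K (expo i j (proj₂ t)) * proj₁ t
                         , (proj₂ t [ i ]%= (_[ j ]%= ℕ.pred)))

  iter : ℕ → (R → R) → R → R
  iter zero    f x = x
  iter (suc k) f x = f (iter k f x)

  E : ℕ → Fin l → Fin l → R → R
  E p i k f = concatMap (λ j → mulVar i j (iter p (∂ k j) f)) (allFin n)

  rowDeg : Mono → Vec ℕ l
  rowDeg = Vec.map Vec.sum

  MultiHom : R → Set ℓ
  MultiHom f = ∃ λ (d : Vec ℕ l) → ∀ m → ¬ (coeff f m ≈ 0#) → rowDeg m ≡ d

  record IsSubspace {v} (V : R → Set v) : Set (c ⊔ ℓ ⊔ v) where
    field
      resp  : ∀ {f g} → f ≈P g → V f → V g
      zero∈ : V 0P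
      +∈    : ∀ {f g} → V f → V g → V (f +P g)
      ·∈    : ∀ a {f} → V f → V (a ·P f)

  lin : List (Carrier × R) → R
  lin = concatMap (λ t → proj₁ t ·P proj₂ t)

  record IsBasis {v b} (V : R → Set v) (B : R → Set b) : Set (lsuc (c ⊔ ℓ) ⊔ v ⊔ b) where
    field
      B⊆V      : ∀ {f} → B f → V f
      spanning : ∀ {f} → V f → ∃ λ (cs : List (Carrier × R)) →
                   All (λ t → B (proj₂ t)) cs × (f ≈P lin cs)
      indep    : ∀ (cs : List (Carrier × R)) →
                   All (λ t → B (proj₂ t)) cs →
                   AllPairs (λ s t → ¬ (proj₂ s ≈P proj₂ t)) cs →
                   lin cs ≈P 0P → All (λ t → proj₁ t ≈ 0#) cs

  record IsHomogeneousSubspace {v} (V : R → Set v) : Set (lsuc (c ⊔ ℓ) ⊔ v) where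
    field
      subspace : IsSubspace V
      basis    : ∃ λ (B : R → Set (c ⊔ ℓ)) → IsBasis V B × (∀ {f} → B f → MultiHom f)

  data 𝒟 {v} (V : R → Set v) : R → Set (c ⊔ ℓ ⊔ v) where
    base  : ∀ {f} → V f → 𝒟 V f
    resp  : ∀ {f g} → f ≈P g → 𝒟 V f → 𝒟 V g
    zero∈ : 𝒟 V 0P
    +∈    : ∀ {f g} → 𝒟 V f → 𝒟 V g → 𝒟 V (f +P g)
    ·∈    : ∀ a {f} → 𝒟 V f → 𝒟 V (a ·P f)
    ∂∈    : ∀ i j {f} → 𝒟 V f → 𝒟 V (∂ i j f)

  data ℰ {v} (V : R → Set v) : R → Set (c ⊔ ℓ ⊔ v) where
    base  : ∀ {f} → V f → ℰ V f
    resp  : ∀ {f g} → f ≈P g → ℰ V f → ℰ V g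
    zero∈ : ℰ V 0P
    +∈    : ∀ {f g} → ℰ V f → ℰ V g → ℰ V (f +P g)
    ·∈    : ∀ a {f} → ℰ V f → ℰ V (a ·P f)
    E∈    : ∀ p i k {f} → ℰ V f → ℰ V (E (suc p) i k f)

module Submission where

-- The whole argument rests on the commutation relation
--   ∂_{ab} E^{(p)}_{ik} = E^{(p)}_{ik} ∂_{ab} + δ_{ia} ∂^p_{kb},
-- which follows from the Leibniz rule ∂_{ab} (x_{ij} h) = x_{ij} ∂_{ab} h + δ_{(i,j),(a,b)} h and the
-- commutation of partial derivatives, both checked coefficientwise. Read as E ∂ = ∂ E − δ ∂ᵖ, it shows
-- that 𝒟(ℰ V) is closed under every E^{(p)}, hence contains ℰ(𝒟 V). Read as ∂ E = E ∂ + δ ∂ᵖ, it shows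
-- that ℰ(𝒟 V) is closed under every word of partial derivatives, hence contains 𝒟(ℰ V).

open import Defs
open import Level using (Level)
open import Data.Nat as ℕ using (ℕ; zero; suc)
open import Data.Nat.Properties using (0≢1+n)
open import Data.Fin as Fin using (Fin)
open import Data.Vec using (lookup; _[_]%=_)
open import Data.Vec.Properties
  using (≡-dec; lookup∘updateAt; lookup∘updateAt′; updateAt-updateAt; updateAt-cong;
         updateAt-id-local; updateAt-commutes)
open import Data.List as List using (List; []; _∷_; _++_; concatMap; allFin)
open import Data.List.Properties using (map-++; map-∘; map-concatMap; concatMap-cong; ++-identityʳ)
open import Data.Product using (_×_; _,_; proj₁; proj₂)
open import Function using (_∘_)
open import Relation.Nullary using (¬_; Dec; yes; no; contradiction)
open import Relation.Nullary.Decidable using (_×-dec_)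
open import Relation.Binary.Bundles using (Setoid)
open import Relation.Unary using (Pred; _⊆_)
open import Relation.Binary.PropositionalEquality as ≡ using (_≡_)
import Relation.Binary.Reasoning.Setoid as SetoidReasoning

module Polarization {c ℓ : Level} (K : Field c ℓ) (l n : ℕ) where
  open Field K
  open Poly K l n
  open import Algebra.Properties.Ring ring using (-1*x≈-x)
  open import Algebra.Properties.CommutativeSemigroup *-commutativeSemigroup using (x∙yz≈y∙xz)
  open import Algebra.Properties.CommutativeSemigroup +-commutativeSemigroup
    using () renaming (interchange to +-interchange)

  updateExpo : Fin l → Fin n → (ℕ → ℕ) → Mono → Mono
  updateExpo i j φ m = m [ i ]%= (_[ j ]%= φ)

  expo-updateExpo : ∀ i j φ m → expo i j (updateExpo i j φ m) ≡ φ (expo i j m)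
  expo-updateExpo i j φ m =
    ≡.trans (≡.cong (λ r → lookup r j) (lookup∘updateAt i m)) (lookup∘updateAt j (lookup m i))

  expo-updateExpo-other : ∀ {i j a b} φ m → ¬ (a ≡ i × b ≡ j) →
                          expo a b (updateExpo i j φ m) ≡ expo a b m
  expo-updateExpo-other {i} {j} {a} {b} φ m a,b≢i,j with a Fin.≟ i
  ... | no a≢i     = ≡.cong (λ r → lookup r b) (lookup∘updateAt′ a i a≢i m)
  ... | yes ≡.refl = ≡.trans (≡.cong (λ r → lookup r b) (lookup∘updateAt a m))
                             (lookup∘updateAt′ b j (λ b≡j → a,b≢i,j (≡.refl , b≡j)) (lookup m a))

  updateExpo-∘ : ∀ i j φ ψ m → updateExpo i j φ (updateExpo i j ψ m) ≡ updateExpo i j (φ ∘ ψ) m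
  updateExpo-∘ i j φ ψ m =
    ≡.trans (updateAt-updateAt i m) (updateAt-cong i (λ r → updateAt-updateAt j r) m)

  updateExpo-id-local : ∀ i j φ m → φ (expo i j m) ≡ expo i j m → updateExpo i j φ m ≡ m
  updateExpo-id-local i j φ m eq = updateAt-id-local i m (updateAt-id-local j (lookup m i) eq)

  updateExpo-commutes : ∀ {i j a b} φ ψ m → ¬ (a ≡ i × b ≡ j) →
                        updateExpo i j φ (updateExpo a b ψ m) ≡ updateExpo a b ψ (updateExpo i j φ m)
  updateExpo-commutes {i} {j} {a} {b} φ ψ m a,b≢i,j with a Fin.≟ i
  ... | no a≢i     = updateAt-commutes i a (a≢i ∘ ≡.sym) m
  ... | yes ≡.refl = ≡.trans (updateAt-updateAt a m)
      (≡.trans (updateAt-cong a (updateAt-commutes j b (λ j≡b → a,b≢i,j (≡.refl , ≡.sym j≡b))) m)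
               (≡.sym (updateAt-updateAt a m)))

  updateExpo-suc-pred : ∀ i j m {e} → expo i j m ≡ suc e →
                        updateExpo i j suc (updateExpo i j ℕ.pred m) ≡ m
  updateExpo-suc-pred i j m eq = ≡.trans (updateExpo-∘ i j suc ℕ.pred m)
    (updateExpo-id-local i j (suc ∘ ℕ.pred) m (≡.trans (≡.cong (suc ∘ ℕ.pred) eq) (≡.sym eq)))

  updateExpo-pred-suc : ∀ i j m → updateExpo i j ℕ.pred (updateExpo i j suc m) ≡ m
  updateExpo-pred-suc i j m = ≡.trans (updateExpo-∘ i j ℕ.pred suc m) (updateExpo-id-local i j _ m ≡.refl)

  infix 4 _≟ᴹ_
  _≟ᴹ_ : (m m′ : Mono) → Dec (m ≡ m′)
  _≟ᴹ_ = ≡-dec (≡-dec ℕ._≟_)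

  coeff₁ : Term → Mono → Carrier
  coeff₁ t = coeff (t ∷ [])

  coeff₁-≡ : ∀ a m′ m → m′ ≡ m → coeff₁ (a , m′) m ≈ a
  coeff₁-≡ a m′ m m′≡m with m′ ≟ᴹ m
  ... | yes _    = +-identityʳ a
  ... | no m′≢m = contradiction m′≡m m′≢m

  coeff₁-≢ : ∀ a m′ m → ¬ m′ ≡ m → coeff₁ (a , m′) m ≈ 0#
  coeff₁-≢ a m′ m m′≢m with m′ ≟ᴹ m
  ... | yes m′≡m = contradiction m′≡m m′≢m
  ... | no _     = refl

  coeff₁-cong : ∀ {a b} m′ m → a ≈ b → coeff₁ (a , m′) m ≈ coeff₁ (b , m′) m
  coeff₁-cong m′ m a≈b with m′ ≟ᴹ m
  ... | yes _ = +-congʳ a≈b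
  ... | no  _ = refl

  coeff₁-zero : ∀ {a} m′ m → a ≈ 0# → coeff₁ (a , m′) m ≈ 0#
  coeff₁-zero {a} m′ m a≈0 with m′ ≟ᴹ m
  ... | yes _ = trans (+-identityʳ a) a≈0
  ... | no  _ = refl

  coeff₁-* : ∀ x a m′ m → coeff₁ (x * a , m′) m ≈ x * coeff₁ (a , m′) m
  coeff₁-* x a m′ m with m′ ≟ᴹ m
  ... | yes _ = trans (+-identityʳ _) (*-congˡ (sym (+-identityʳ a)))
  ... | no  _ = sym (zeroʳ x)

  coeff-∷ : ∀ t p m → coeff (t ∷ p) m ≈ coeff₁ t m + coeff p m
  coeff-∷ (a , m′) p m with m′ ≟ᴹ m
  ... | yes _ = +-congʳ (sym (+-identityʳ a))
  ... | no  _ = sym (+-identityˡ _)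

  coeff-++ : ∀ p q m → coeff (p ++ q) m ≈ coeff p m + coeff q m
  coeff-++ []      q m = sym (+-identityˡ _)
  coeff-++ (t ∷ p) q m = begin
    coeff (t ∷ p ++ q) m                     ≈⟨ coeff-∷ t (p ++ q) m ⟩
    coeff₁ t m + coeff (p ++ q) m            ≈⟨ +-congˡ (coeff-++ p q m) ⟩
    coeff₁ t m + (coeff p m + coeff q m)     ≈⟨ +-assoc _ _ _ ⟨
    (coeff₁ t m + coeff p m) + coeff q m     ≈⟨ +-congʳ (coeff-∷ t p m) ⟨
    coeff (t ∷ p) m + coeff q m              ∎
    where open SetoidReasoning setoid

  coeff-map : ∀ (T : Term → Term) x {m m′} → (∀ t → coeff₁ (T t) m ≈ x * coeff₁ t m′) →
              ∀ f → coeff (List.map T f) m ≈ x * coeff f m′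
  coeff-map T x         H []      = sym (zeroʳ x)
  coeff-map T x {m} {m′} H (t ∷ f) = begin
    coeff (T t ∷ List.map T f) m              ≈⟨ coeff-∷ (T t) _ m ⟩
    coeff₁ (T t) m + coeff (List.map T f) m   ≈⟨ +-cong (H t) (coeff-map T x H f) ⟩
    x * coeff₁ t m′ + x * coeff f m′          ≈⟨ distribˡ x _ _ ⟨
    x * (coeff₁ t m′ + coeff f m′)            ≈⟨ *-congˡ (coeff-∷ t f m′) ⟨
    x * coeff (t ∷ f) m′                      ∎
    where open SetoidReasoning setoid

  -- _≈P_ unfolds to a function type from which Agda cannot infer the two polynomials, so identities
  -- are stated with this wrapper, which keeps them visible to unification.
  infix 4 _≋_
  record _≋_ (f g : R) : Set ℓ where
    constructor coeffwise
    field coeff-≈ : f ≈P g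
  open _≋_ public

  ≋-setoid : Setoid c ℓ
  ≋-setoid = record
    { Carrier       = R
    ; _≈_           = _≋_
    ; isEquivalence = record
      { refl  = coeffwise λ _ → refl
      ; sym   = λ (coeffwise f≈g) → coeffwise λ m → sym (f≈g m)
      ; trans = λ (coeffwise f≈g) (coeffwise g≈h) → coeffwise λ m → trans (f≈g m) (g≈h m)
      }
    }

  open Setoid ≋-setoid public using ()
    renaming (refl to ≋-refl; sym to ≋-sym; trans to ≋-trans; reflexive to ≋-reflexive)
  module ≋-Reasoning = SetoidReasoning ≋-setoid

  ++-cong : ∀ {f f′ g g′} → f ≋ f′ → g ≋ g′ → f ++ g ≋ f′ ++ g′
  ++-cong {f} {f′} {g} {g′} (coeffwise f≈f′) (coeffwise g≈g′) = coeffwise λ m →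
    trans (coeff-++ f g m) (trans (+-cong (f≈f′ m) (g≈g′ m)) (sym (coeff-++ f′ g′ m)))

  infix 4 _≈ᵀ_
  _≈ᵀ_ : Term → Term → Set ℓ
  s ≈ᵀ t = proj₁ s ≈ proj₁ t × proj₂ s ≡ proj₂ t

  map-cong-≈ᵀ : ∀ {T U : Term → Term} → (∀ t → T t ≈ᵀ U t) → ∀ f → List.map T f ≋ List.map U f
  map-cong-≈ᵀ {T} {U} T≈U f = coeffwise (pointwise f)
    where
    pointwise : ∀ f → List.map T f ≈P List.map U f
    pointwise []      m = refl
    pointwise (t ∷ f) m with T≈U t
    ... | a≈b , m′≡m″ = begin
      coeff (T t ∷ List.map T f) m              ≈⟨ coeff-∷ (T t) _ m ⟩
      coeff₁ (T t) m + coeff (List.map T f) m   ≈⟨ +-cong (coeff₁-cong (proj₂ (T t)) m a≈b) (pointwise f m) ⟩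
      coeff₁ (proj₁ (U t) , proj₂ (T t)) m + coeff (List.map U f) m
        ≡⟨ ≡.cong (λ m′ → coeff₁ (proj₁ (U t) , m′) m + coeff (List.map U f) m) m′≡m″ ⟩
      coeff₁ (U t) m + coeff (List.map U f) m   ≈⟨ coeff-∷ (U t) _ m ⟨
      coeff (U t ∷ List.map U f) m              ∎
      where open SetoidReasoning setoid

  map-commute : ∀ (T U : Term → Term) → (∀ t → T (U t) ≈ᵀ U (T t)) →
                ∀ f → List.map T (List.map U f) ≋ List.map U (List.map T f)
  map-commute T U TU≈UT f = begin
    List.map T (List.map U f)  ≡⟨ map-∘ f ⟨
    List.map (T ∘ U) f         ≈⟨ map-cong-≈ᵀ TU≈UT f ⟩
    List.map (U ∘ T) f         ≡⟨ map-∘ f ⟩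
    List.map U (List.map T f)  ∎
    where open ≋-Reasoning

  -- Partial derivatives, multiplication by a variable and scaling

  K⟨_⟩ : ℕ → Carrier
  K⟨_⟩ = ℕ→K K

  -- ∂ a b, mulVar i j and y ·P_ are, definitionally, List.map of these termwise actions.
  ∂ᵗ : Fin l → Fin n → Term → Term
  ∂ᵗ a b (x , m) = K⟨ expo a b m ⟩ * x , updateExpo a b ℕ.pred m

  mulVarᵗ : Fin l → Fin n → Term → Term
  mulVarᵗ i j (x , m) = x , updateExpo i j suc m

  scaleᵗ : Carrier → Term → Term
  scaleᵗ y (x , m) = y * x , m

  coeff-· : ∀ y f m → coeff (y ·P f) m ≈ y * coeff f m
  coeff-· y f m = coeff-map (scaleᵗ y) y (λ (x , m′) → coeff₁-* y x m′ m) f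

  coeff-∂ : ∀ a b f m → coeff (∂ a b f) m ≈ K⟨ suc (expo a b m) ⟩ * coeff f (updateExpo a b suc m)
  coeff-∂ a b f m = coeff-map (∂ᵗ a b) _ coeff₁-∂ᵗ f
    where
    m⁺ = updateExpo a b suc m
    coeff₁-∂ᵗ : ∀ t → coeff₁ (∂ᵗ a b t) m ≈ K⟨ suc (expo a b m) ⟩ * coeff₁ t m⁺
    coeff₁-∂ᵗ (x , m′) = byCases (m′ ≟ᴹ m⁺)
      where
      byCases : Dec (m′ ≡ m⁺) → coeff₁ (∂ᵗ a b (x , m′)) m ≈ K⟨ suc (expo a b m) ⟩ * coeff₁ (x , m′) m⁺
      byCases (yes ≡.refl) = trans (coeff₁-≡ _ _ m (updateExpo-pred-suc a b m))
        (trans (*-congʳ (reflexive (≡.cong K⟨_⟩ (expo-updateExpo a b suc m))))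
               (*-congˡ (sym (coeff₁-≡ x m⁺ m⁺ ≡.refl))))
      byCases (no m′≢m⁺) = trans (lhs≈0 (expo a b m′) ≡.refl)
                                 (sym (trans (*-congˡ (coeff₁-≢ x m′ m⁺ m′≢m⁺)) (zeroʳ _)))
        where
        lhs≈0 : ∀ e → expo a b m′ ≡ e → coeff₁ (∂ᵗ a b (x , m′)) m ≈ 0#
        lhs≈0 zero    eq = coeff₁-zero (updateExpo a b ℕ.pred m′) m
                                        (trans (*-congʳ (reflexive (≡.cong K⟨_⟩ eq))) (zeroˡ x))
        lhs≈0 (suc e) eq = coeff₁-≢ _ (updateExpo a b ℕ.pred m′) m λ m′⁻≡m →
          m′≢m⁺ (≡.trans (≡.sym (updateExpo-suc-pred a b m′ eq)) (≡.cong (updateExpo a b suc) m′⁻≡m))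

  coeff-mulVar-zero : ∀ i j f m → expo i j m ≡ 0 → coeff (mulVar i j f) m ≈ 0#
  coeff-mulVar-zero i j f m eq =
    trans (coeff-map (mulVarᵗ i j) 0# {m′ = m} coeff₁-mulVarᵗ f) (zeroˡ _)
    where
    coeff₁-mulVarᵗ : ∀ t → coeff₁ (mulVarᵗ i j t) m ≈ 0# * coeff₁ t m
    coeff₁-mulVarᵗ (x , m′) = trans (coeff₁-≢ x (updateExpo i j suc m′) m m′⁺≢m) (sym (zeroˡ _))
      where
      m′⁺≢m : ¬ updateExpo i j suc m′ ≡ m
      m′⁺≢m m′⁺≡m = 0≢1+n (≡.trans (≡.sym eq)
        (≡.trans (≡.cong (expo i j) (≡.sym m′⁺≡m)) (expo-updateExpo i j suc m′)))

  coeff-mulVar-suc : ∀ i j f m {e} → expo i j m ≡ suc e →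
                     coeff (mulVar i j f) m ≈ coeff f (updateExpo i j ℕ.pred m)
  coeff-mulVar-suc i j f m eq =
    trans (coeff-map (mulVarᵗ i j) 1# coeff₁-mulVarᵗ f) (*-identityˡ _)
    where
    m⁻ = updateExpo i j ℕ.pred m
    coeff₁-mulVarᵗ : ∀ t → coeff₁ (mulVarᵗ i j t) m ≈ 1# * coeff₁ t m⁻
    coeff₁-mulVarᵗ (x , m′) = trans (byCases (m′ ≟ᴹ m⁻)) (sym (*-identityˡ _))
      where
      byCases : Dec (m′ ≡ m⁻) → coeff₁ (mulVarᵗ i j (x , m′)) m ≈ coeff₁ (x , m′) m⁻
      byCases (yes ≡.refl) = trans (coeff₁-≡ x (updateExpo i j suc m⁻) m (updateExpo-suc-pred i j m eq))
                                   (sym (coeff₁-≡ x m⁻ m⁻ ≡.refl))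
      byCases (no m′≢m⁻)   = trans (coeff₁-≢ x (updateExpo i j suc m′) m λ m′⁺≡m → m′≢m⁻
                                     (≡.trans (≡.sym (updateExpo-pred-suc i j m′))
                                              (≡.cong (updateExpo i j ℕ.pred) m′⁺≡m)))
                                   (sym (coeff₁-≢ x m′ m⁻ m′≢m⁻))

  ∂-cong : ∀ a b {f g} → f ≋ g → ∂ a b f ≋ ∂ a b g
  ∂-cong a b {f} {g} (coeffwise f≈g) = coeffwise λ m →
    trans (coeff-∂ a b f m) (trans (*-congˡ (f≈g _)) (sym (coeff-∂ a b g m)))

  mulVar-cong : ∀ i j {f g} → f ≋ g → mulVar i j f ≋ mulVar i j g
  mulVar-cong i j {f} {g} (coeffwise f≈g) = coeffwise pointwise
    where
    pointwise : mulVar i j f ≈P mulVar i j g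
    pointwise m with expo i j m in eq
    ... | zero  = trans (coeff-mulVar-zero i j f m eq) (sym (coeff-mulVar-zero i j g m eq))
    ... | suc _ = trans (coeff-mulVar-suc i j f m eq) (trans (f≈g _) (sym (coeff-mulVar-suc i j g m eq)))

  ∂-· : ∀ a b y f → ∂ a b (y ·P f) ≋ y ·P ∂ a b f
  ∂-· a b y = map-commute (∂ᵗ a b) (scaleᵗ y) λ (x , m) → x∙yz≈y∙xz _ y x , ≡.refl

  mulVar-· : ∀ i j y f → mulVar i j (y ·P f) ≋ y ·P mulVar i j f
  mulVar-· i j y = map-commute (mulVarᵗ i j) (scaleᵗ y) λ _ → refl , ≡.refl

  ≢-sym : ∀ {a i : Fin l} {b j : Fin n} → ¬ (a ≡ i × b ≡ j) → ¬ (i ≡ a × j ≡ b)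
  ≢-sym a,b≢i,j (i≡a , j≡b) = a,b≢i,j (≡.sym i≡a , ≡.sym j≡b)

  ∂-∂-comm : ∀ a b k j f → ∂ a b (∂ k j f) ≋ ∂ k j (∂ a b f)
  ∂-∂-comm a b k j f with (a Fin.≟ k) ×-dec (b Fin.≟ j)
  ... | yes (≡.refl , ≡.refl) = ≋-refl
  ... | no a,b≢k,j = map-commute (∂ᵗ a b) (∂ᵗ k j) ∂ᵗ-comm f
    where
    ∂ᵗ-comm : ∀ t → ∂ᵗ a b (∂ᵗ k j t) ≈ᵀ ∂ᵗ k j (∂ᵗ a b t)
    ∂ᵗ-comm (x , m) =
      trans (*-congʳ (reflexive (≡.cong K⟨_⟩ (expo-updateExpo-other ℕ.pred m a,b≢k,j))))
        (trans (x∙yz≈y∙xz _ _ x)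
          (*-congʳ (reflexive (≡.cong K⟨_⟩ (≡.sym (expo-updateExpo-other ℕ.pred m (≢-sym a,b≢k,j)))))))
      , updateExpo-commutes ℕ.pred ℕ.pred m (≢-sym a,b≢k,j)

  ∂-mulVar-other : ∀ i j a b h → ¬ (a ≡ i × b ≡ j) → ∂ a b (mulVar i j h) ≋ mulVar i j (∂ a b h)
  ∂-mulVar-other i j a b h a,b≢i,j = map-commute (∂ᵗ a b) (mulVarᵗ i j) ∂ᵗ-mulVarᵗ h
    where
    ∂ᵗ-mulVarᵗ : ∀ t → ∂ᵗ a b (mulVarᵗ i j t) ≈ᵀ mulVarᵗ i j (∂ᵗ a b t)
    ∂ᵗ-mulVarᵗ (x , m) = *-congʳ (reflexive (≡.cong K⟨_⟩ (expo-updateExpo-other suc m a,b≢i,j)))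
                       , ≡.sym (updateExpo-commutes suc ℕ.pred m a,b≢i,j)

  ∂-mulVar-same : ∀ i j h → ∂ i j (mulVar i j h) ≋ mulVar i j (∂ i j h) ++ h
  ∂-mulVar-same i j h = coeffwise pointwise
    where
    pointwise : ∂ i j (mulVar i j h) ≈P mulVar i j (∂ i j h) ++ h
    pointwise m = begin
      coeff (∂ i j (mulVar i j h)) m
        ≈⟨ coeff-∂ i j (mulVar i j h) m ⟩
      K⟨ suc (expo i j m) ⟩ * coeff (mulVar i j h) (updateExpo i j suc m)
        ≈⟨ *-congˡ (coeff-mulVar-suc i j h _ (expo-updateExpo i j suc m)) ⟩
      K⟨ suc (expo i j m) ⟩ * coeff h (updateExpo i j ℕ.pred (updateExpo i j suc m))
        ≡⟨ ≡.cong (λ m′ → K⟨ suc (expo i j m) ⟩ * coeff h m′) (updateExpo-pred-suc i j m) ⟩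
      K⟨ suc (expo i j m) ⟩ * coeff h m
        ≈⟨ byExponent (expo i j m) ≡.refl ⟩
      coeff (mulVar i j (∂ i j h)) m + coeff h m
        ≈⟨ coeff-++ (mulVar i j (∂ i j h)) h m ⟨
      coeff (mulVar i j (∂ i j h) ++ h) m ∎
      where
      open SetoidReasoning setoid
      byExponent : ∀ e → expo i j m ≡ e → K⟨ suc e ⟩ * coeff h m ≈ coeff (mulVar i j (∂ i j h)) m + coeff h m
      byExponent zero eq = begin
        (1# + 0#) * coeff h m                        ≈⟨ *-congʳ (+-identityʳ 1#) ⟩
        1# * coeff h m                               ≈⟨ *-identityˡ _ ⟩
        coeff h m                                    ≈⟨ +-identityˡ _ ⟨
        0# + coeff h m                               ≈⟨ +-congʳ (coeff-mulVar-zero i j (∂ i j h) m eq) ⟨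
        coeff (mulVar i j (∂ i j h)) m + coeff h m   ∎
      byExponent (suc e) eq = begin
        (1# + K⟨ suc e ⟩) * coeff h m                    ≈⟨ distribʳ _ 1# _ ⟩
        1# * coeff h m + K⟨ suc e ⟩ * coeff h m          ≈⟨ +-comm _ _ ⟩
        K⟨ suc e ⟩ * coeff h m + 1# * coeff h m          ≈⟨ +-congˡ (*-identityˡ _) ⟩
        K⟨ suc e ⟩ * coeff h m + coeff h m
          ≡⟨ ≡.cong₂ (λ e′ m′ → K⟨ suc e′ ⟩ * coeff h m′ + coeff h m)
                     (≡.sym (≡.trans (expo-updateExpo i j ℕ.pred m) (≡.cong ℕ.pred eq)))
                     (≡.sym (updateExpo-suc-pred i j m eq)) ⟩
        K⟨ suc (expo i j m⁻) ⟩ * coeff h (updateExpo i j suc m⁻) + coeff h m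
          ≈⟨ +-congʳ (coeff-∂ i j h m⁻) ⟨
        coeff (∂ i j h) m⁻ + coeff h m                   ≈⟨ +-congʳ (coeff-mulVar-suc i j (∂ i j h) m eq) ⟨
        coeff (mulVar i j (∂ i j h)) m + coeff h m       ∎
        where m⁻ = updateExpo i j ℕ.pred m

  δ : Fin l → Fin n → Fin l → Fin n → R → R
  δ i j a b h with (i Fin.≟ a) ×-dec (j Fin.≟ b)
  ... | yes _ = h
  ... | no  _ = []

  δ-closed : ∀ {s} (S : R → Set s) → S [] → ∀ i j a b {h} → S h → S (δ i j a b h)
  δ-closed S S[] i j a b Sh with (i Fin.≟ a) ×-dec (j Fin.≟ b)
  ... | yes _ = Sh
  ... | no  _ = S[]

  ∂-mulVar : ∀ i j a b h → ∂ a b (mulVar i j h) ≋ mulVar i j (∂ a b h) ++ δ i j a b h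
  ∂-mulVar i j a b h with (i Fin.≟ a) ×-dec (j Fin.≟ b)
  ... | yes (≡.refl , ≡.refl) = ∂-mulVar-same i j h
  ... | no i,j≢a,b = ≋-trans (∂-mulVar-other i j a b h (≢-sym i,j≢a,b))
                             (≋-reflexive (≡.sym (++-identityʳ _)))

  -- Iterated derivatives and the polarization operators

  iter-cong : ∀ {F : R → R} → (∀ {f g} → f ≋ g → F f ≋ F g) →
              ∀ p {f g} → f ≋ g → iter p F f ≋ iter p F g
  iter-cong F-cong zero    f≋g = f≋g
  iter-cong F-cong (suc p) f≋g = F-cong (iter-cong F-cong p f≋g)

  iter-++ : ∀ {F : R → R} → (∀ f g → F (f ++ g) ≡ F f ++ F g) →
            ∀ p f g → iter p F (f ++ g) ≡ iter p F f ++ iter p F g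
  iter-++         F-++ zero    f g = ≡.refl
  iter-++ {F = F} F-++ (suc p) f g = ≡.trans (≡.cong F (iter-++ F-++ p f g)) (F-++ _ _)

  iter-commute : ∀ {F G : R → R} → (∀ {f g} → f ≋ g → F f ≋ F g) → (∀ f → G (F f) ≋ F (G f)) →
                 ∀ p f → G (iter p F f) ≋ iter p F (G f)
  iter-commute F-cong GF≋FG zero    f = ≋-refl
  iter-commute F-cong GF≋FG (suc p) f = ≋-trans (GF≋FG _) (F-cong (iter-commute F-cong GF≋FG p f))

  iter-closed : ∀ {s} {S : R → Set s} {F : R → R} → (∀ {f} → S f → S (F f)) →
                ∀ p {f} → S f → S (iter p F f)
  iter-closed F-closed zero    Sf = Sf
  iter-closed {S = S} {F} F-closed (suc p) Sf = F-closed (iter-closed {S = S} {F} F-closed p Sf)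

  iter-suc′ : ∀ (F : R → R) p f → iter (suc p) F f ≡ iter p F (F f)
  iter-suc′ F zero    f = ≡.refl
  iter-suc′ F (suc p) f = ≡.cong F (iter-suc′ F p f)

  concatMap-cong-≋ : ∀ {A : Set} {h h′ : A → R} → (∀ x → h x ≋ h′ x) →
                     ∀ xs → concatMap h xs ≋ concatMap h′ xs
  concatMap-cong-≋ h≋h′ []       = ≋-refl
  concatMap-cong-≋ h≋h′ (x ∷ xs) = ++-cong (h≋h′ x) (concatMap-cong-≋ h≋h′ xs)

  concatMap-++-≋ : ∀ {A : Set} (h h′ : A → R) xs →
                   concatMap (λ x → h x ++ h′ x) xs ≋ concatMap h xs ++ concatMap h′ xs
  concatMap-++-≋ h h′ xs = coeffwise (pointwise xs)
    where
    pointwise : ∀ xs → concatMap (λ x → h x ++ h′ x) xs ≈P concatMap h xs ++ concatMap h′ xs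
    pointwise []       m = refl
    pointwise (x ∷ xs) m = begin
      coeff ((h x ++ h′ x) ++ concatMap (λ x → h x ++ h′ x) xs) m
        ≈⟨ coeff-++ (h x ++ h′ x) _ m ⟩
      coeff (h x ++ h′ x) m + coeff (concatMap (λ x → h x ++ h′ x) xs) m
        ≈⟨ +-cong (coeff-++ (h x) (h′ x) m)
                  (trans (pointwise xs m) (coeff-++ (concatMap h xs) _ m)) ⟩
      (coeff (h x) m + coeff (h′ x) m) + (coeff (concatMap h xs) m + coeff (concatMap h′ xs) m)
        ≈⟨ +-interchange _ _ _ _ ⟩
      (coeff (h x) m + coeff (concatMap h xs) m) + (coeff (h′ x) m + coeff (concatMap h′ xs) m)
        ≈⟨ +-cong (coeff-++ (h x) _ m) (coeff-++ (h′ x) _ m) ⟨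
      coeff (concatMap h (x ∷ xs)) m + coeff (concatMap h′ (x ∷ xs)) m
        ≈⟨ coeff-++ (concatMap h (x ∷ xs)) _ m ⟨
      coeff (concatMap h (x ∷ xs) ++ concatMap h′ (x ∷ xs)) m ∎
      where open SetoidReasoning setoid

  concatMap-closed : ∀ {A : Set} {s} (S : R → Set s) → S [] → (∀ {f g} → S f → S g → S (f ++ g)) →
                     ∀ {h : A → R} → (∀ x → S (h x)) → ∀ xs → S (concatMap h xs)
  concatMap-closed S S[] S++ Sh []       = S[]
  concatMap-closed S S[] S++ Sh (x ∷ xs) = S++ (Sh x) (concatMap-closed S S[] S++ Sh xs)

  E-cong : ∀ p i k {f g} → f ≋ g → E p i k f ≋ E p i k g
  E-cong p i k f≋g = concatMap-cong-≋ (λ j → mulVar-cong i j (iter-cong (∂-cong k j) p f≋g)) (allFin n)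

  E-· : ∀ p i k y f → E p i k (y ·P f) ≋ y ·P E p i k f
  E-· p i k y f = begin
    E p i k (y ·P f)
      ≈⟨ concatMap-cong-≋ (λ j → ≋-trans (mulVar-cong i j (∂ᵖ-· j)) (mulVar-· i j y _)) (allFin n) ⟩
    concatMap (λ j → y ·P mulVar i j (iter p (∂ k j) f)) (allFin n)
      ≡⟨ map-concatMap (scaleᵗ y) _ (allFin n) ⟨
    y ·P E p i k f ∎
    where
    open ≋-Reasoning
    ∂ᵖ-· : ∀ j → iter p (∂ k j) (y ·P f) ≋ y ·P iter p (∂ k j) f
    ∂ᵖ-· j = ≋-sym (iter-commute (∂-cong k j) (λ g → ≋-sym (∂-· k j y g)) p f)

  E-++ : ∀ p i k f g → E p i k (f ++ g) ≋ E p i k f ++ E p i k g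
  E-++ p i k f g = begin
    E p i k (f ++ g)
      ≡⟨ concatMap-cong (λ j → ≡.trans (≡.cong (mulVar i j) (iter-++ (map-++ (∂ᵗ k j)) p f g))
                                       (map-++ (mulVarᵗ i j) (iter p (∂ k j) f) (iter p (∂ k j) g)))
                        (allFin n) ⟩
    concatMap (λ j → mulVar i j (iter p (∂ k j) f) ++ mulVar i j (iter p (∂ k j) g)) (allFin n)
      ≈⟨ concatMap-++-≋ _ _ (allFin n) ⟩
    E p i k f ++ E p i k g ∎
    where open ≋-Reasoning

  E-[] : ∀ p i k → E p i k [] ≋ []
  E-[] p i k = coeffwise λ m →
    trans (coeff-≈ (E-· p i k 0# []) m) (trans (coeff-· 0# (E p i k []) m) (zeroˡ _))

  -- δ∂ p i k a b g encodes δ_{ia} ∂ᵖ_{kb} g as Σⱼ δ_{(i,j),(a,b)} ∂ᵖ_{kj} g.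
  δ∂ : ℕ → Fin l → Fin l → Fin l → Fin n → R → R
  δ∂ p i k a b g = concatMap (λ j → δ i j a b (iter p (∂ k j) g)) (allFin n)

  δ∂-closed : ∀ {s} (S : R → Set s) → S [] → (∀ {f g} → S f → S g → S (f ++ g)) →
              ∀ p i k a b {g} → (∀ j → S (iter p (∂ k j) g)) → S (δ∂ p i k a b g)
  δ∂-closed S S[] S++ p i k a b S∂ᵖg =
    concatMap-closed S S[] S++ (λ j → δ-closed S S[] i j a b (S∂ᵖg j)) (allFin n)

  ∂-E : ∀ p i k a b g → ∂ a b (E p i k g) ≋ E p i k (∂ a b g) ++ δ∂ p i k a b g
  ∂-E p i k a b g = begin
    ∂ a b (E p i k g)
      ≡⟨ map-concatMap (∂ᵗ a b) _ (allFin n) ⟩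
    concatMap (λ j → ∂ a b (mulVar i j (iter p (∂ k j) g))) (allFin n)
      ≈⟨ concatMap-cong-≋ (λ j → ≋-trans (∂-mulVar i j a b _) (++-cong (mulVar-cong i j ∂∂ᵖ≋∂ᵖ∂) ≋-refl))
                          (allFin n) ⟩
    concatMap (λ j → mulVar i j (iter p (∂ k j) (∂ a b g)) ++ δ i j a b (iter p (∂ k j) g)) (allFin n)
      ≈⟨ concatMap-++-≋ _ _ (allFin n) ⟩
    E p i k (∂ a b g) ++ δ∂ p i k a b g ∎
    where
    open ≋-Reasoning
    ∂∂ᵖ≋∂ᵖ∂ : ∀ {j} → ∂ a b (iter p (∂ k j) g) ≋ iter p (∂ k j) (∂ a b g)
    ∂∂ᵖ≋∂ᵖ∂ {j} = iter-commute (∂-cong k j) (∂-∂-comm a b k j) p g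

  ++-moveʳ : ∀ {f g h} → f ≋ g ++ h → f ++ ((- 1#) ·P h) ≋ g
  ++-moveʳ {f} {g} {h} (coeffwise f≈g+h) = coeffwise λ m → begin
    coeff (f ++ ((- 1#) ·P h)) m                 ≈⟨ coeff-++ f _ m ⟩
    coeff f m + coeff ((- 1#) ·P h) m            ≈⟨ +-cong (trans (f≈g+h m) (coeff-++ g h m)) (coeff-· (- 1#) h m) ⟩
    (coeff g m + coeff h m) + - 1# * coeff h m ≈⟨ +-congˡ (-1*x≈-x _) ⟩
    (coeff g m + coeff h m) + - coeff h m      ≈⟨ +-assoc _ _ _ ⟩
    coeff g m + (coeff h m + - coeff h m)      ≈⟨ +-congˡ (-‿inverseʳ _) ⟩
    coeff g m + 0#                             ≈⟨ +-identityʳ _ ⟩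
    coeff g m                                  ∎
    where open SetoidReasoning setoid

  𝒟-isSubspace : ∀ {w} {W : Pred R w} → IsSubspace (𝒟 W)
  𝒟-isSubspace = record { resp = resp ; zero∈ = zero∈ ; +∈ = +∈ ; ·∈ = ·∈ }

  ℰ-isSubspace : ∀ {w} {W : Pred R w} → IsSubspace (ℰ W)
  ℰ-isSubspace = record { resp = resp ; zero∈ = zero∈ ; +∈ = +∈ ; ·∈ = ·∈ }

  module _ {w u} {W : Pred R w} {U : Pred R u} (W⊆U : W ⊆ U) (U-subspace : IsSubspace U) where
    private module U = IsSubspace U-subspace

    𝒟-minimal : (∀ a b {f} → U f → U (∂ a b f)) → 𝒟 W ⊆ U
    𝒟-minimal U-∂ (base w)    = W⊆U w
    𝒟-minimal U-∂ (resp e d)  = U.resp e (𝒟-minimal U-∂ d)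
    𝒟-minimal U-∂ zero∈       = U.zero∈
    𝒟-minimal U-∂ (+∈ d d′)   = U.+∈ (𝒟-minimal U-∂ d) (𝒟-minimal U-∂ d′)
    𝒟-minimal U-∂ (·∈ y d)    = U.·∈ y (𝒟-minimal U-∂ d)
    𝒟-minimal U-∂ (∂∈ a b d)  = U-∂ a b (𝒟-minimal U-∂ d)

    ℰ-minimal : (∀ p i k {f} → U f → U (E (suc p) i k f)) → ℰ W ⊆ U
    ℰ-minimal U-E (base w)     = W⊆U w
    ℰ-minimal U-E (resp e d)   = U.resp e (ℰ-minimal U-E d)
    ℰ-minimal U-E zero∈        = U.zero∈
    ℰ-minimal U-E (+∈ d d′)    = U.+∈ (ℰ-minimal U-E d) (ℰ-minimal U-E d′)
    ℰ-minimal U-E (·∈ y d)     = U.·∈ y (ℰ-minimal U-E d)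
    ℰ-minimal U-E (E∈ p i k d) = U-E p i k (ℰ-minimal U-E d)

  𝒟-preserves-E-closure : ∀ {w} {W : Pred R w} → (∀ p i k {f} → W f → W (E (suc p) i k f)) →
                          ∀ p i k {f} → 𝒟 W f → 𝒟 W (E (suc p) i k f)
  𝒟-preserves-E-closure W-E p i k (base w)   = base (W-E p i k w)
  𝒟-preserves-E-closure W-E p i k (resp e d) =
    resp (coeff-≈ (E-cong (suc p) i k (coeffwise e))) (𝒟-preserves-E-closure W-E p i k d)
  𝒟-preserves-E-closure W-E p i k zero∈      = resp (coeff-≈ (≋-sym (E-[] (suc p) i k))) zero∈
  𝒟-preserves-E-closure W-E p i k (+∈ d d′)  =
    resp (coeff-≈ (≋-sym (E-++ (suc p) i k _ _)))
         (+∈ (𝒟-preserves-E-closure W-E p i k d) (𝒟-preserves-E-closure W-E p i k d′))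
  𝒟-preserves-E-closure W-E p i k (·∈ y d)   =
    resp (coeff-≈ (≋-sym (E-· (suc p) i k y _))) (·∈ y (𝒟-preserves-E-closure W-E p i k d))
  𝒟-preserves-E-closure {W = W} W-E p i k (∂∈ a b {f} d) =
    resp (coeff-≈ (++-moveʳ (∂-E (suc p) i k a b f)))
         (+∈ (∂∈ a b (𝒟-preserves-E-closure W-E p i k d)) (·∈ (- 1#) δ∂f∈𝒟W))
    where
    δ∂f∈𝒟W : 𝒟 W (δ∂ (suc p) i k a b f)
    δ∂f∈𝒟W = δ∂-closed (𝒟 W) zero∈ +∈ (suc p) i k a b λ j →
               iter-closed {S = 𝒟 W} {∂ k j} (∂∈ k j) (suc p) d

  ∂* : List (Fin l × Fin n) → R → R
  ∂* []             f = f
  ∂* ((a , b) ∷ ws) f = ∂* ws (∂ a b f)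

  ∂*-++ : ∀ ws f g → ∂* ws (f ++ g) ≡ ∂* ws f ++ ∂* ws g
  ∂*-++ []             f g = ≡.refl
  ∂*-++ ((a , b) ∷ ws) f g =
    ≡.trans (≡.cong (∂* ws) (map-++ (∂ᵗ a b) f g)) (∂*-++ ws (∂ a b f) (∂ a b g))

  ∂*-[] : ∀ ws → ∂* ws [] ≡ []
  ∂*-[] []             = ≡.refl
  ∂*-[] ((a , b) ∷ ws) = ∂*-[] ws

  ∂*-cong : ∀ ws {f g} → f ≋ g → ∂* ws f ≋ ∂* ws g
  ∂*-cong []             f≋g = f≋g
  ∂*-cong ((a , b) ∷ ws) f≋g = ∂*-cong ws (∂-cong a b f≋g)

  ∂*-· : ∀ ws y f → ∂* ws (y ·P f) ≋ y ·P ∂* ws f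
  ∂*-· []             y f = ≋-refl
  ∂*-· ((a , b) ∷ ws) y f = ≋-trans (∂*-cong ws (∂-· a b y f)) (∂*-· ws y (∂ a b f))

  ∂*-replicate : ∀ q k j ws f → ∂* (List.replicate q (k , j) ++ ws) f ≡ ∂* ws (iter q (∂ k j) f)
  ∂*-replicate zero    k j ws f = ≡.refl
  ∂*-replicate (suc q) k j ws f =
    ≡.trans (∂*-replicate q k j ws (∂ k j f)) (≡.cong (∂* ws) (≡.sym (iter-suc′ (∂ k j) q f)))

  ∂*-closed : ∀ {w} {W : Pred R w} → (∀ a b {f} → W f → W (∂ a b f)) → ∀ ws {f} → W f → W (∂* ws f)
  ∂*-closed W-∂ []             Wf = Wf
  ∂*-closed W-∂ ((a , b) ∷ ws) Wf = ∂*-closed W-∂ ws (W-∂ a b Wf)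

  ℰ-∂*-[] : ∀ {w} {W : Pred R w} ws → ℰ W (∂* ws [])
  ℰ-∂*-[] {W = W} ws = ≡.subst (ℰ W) (≡.sym (∂*-[] ws)) zero∈

  ℰ-∂*-++ : ∀ {w} {W : Pred R w} ws {f g} → ℰ W (∂* ws f) → ℰ W (∂* ws g) → ℰ W (∂* ws (f ++ g))
  ℰ-∂*-++ {W = W} ws d d′ = ≡.subst (ℰ W) (≡.sym (∂*-++ ws _ _)) (+∈ d d′)

  -- Induction on ℰ W for a single ∂ breaks down at E∈, where ∂ E g brings in ∂ᵖ g;
  -- closure under arbitrary words of derivatives is what goes through.
  module _ {w} {W : Pred R w} (W-∂ : ∀ a b {f} → W f → W (∂ a b f)) where

    ∂*-E-closed : ∀ p i k ws {g} → (∀ ws → ℰ W (∂* ws g)) → ℰ W (∂* ws (E (suc p) i k g))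
    ∂*-E-closed p i k []                 ℰ∂*g = E∈ p i k (ℰ∂*g [])
    ∂*-E-closed p i k ((a , b) ∷ ws) {g} ℰ∂*g =
      resp (coeff-≈ (≋-sym (∂*-cong ws (∂-E (suc p) i k a b g))))
           (ℰ-∂*-++ ws (∂*-E-closed p i k ws (λ ws′ → ℰ∂*g ((a , b) ∷ ws′))) ℰ∂*δ∂g)
      where
      ℰ∂*δ∂g : ℰ W (∂* ws (δ∂ (suc p) i k a b g))
      ℰ∂*δ∂g = δ∂-closed (ℰ W ∘ ∂* ws) (ℰ-∂*-[] ws) (ℰ-∂*-++ ws) (suc p) i k a b λ j →
                 ≡.subst (ℰ W) (∂*-replicate (suc p) k j ws g) (ℰ∂*g (List.replicate (suc p) (k , j) ++ ws))

    ℰ-∂*-closed : ∀ {f} → ℰ W f → ∀ ws → ℰ W (∂* ws f)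
    ℰ-∂*-closed (base w)     ws = base (∂*-closed W-∂ ws w)
    ℰ-∂*-closed (resp e d)   ws = resp (coeff-≈ (∂*-cong ws (coeffwise e))) (ℰ-∂*-closed d ws)
    ℰ-∂*-closed zero∈        ws = ℰ-∂*-[] ws
    ℰ-∂*-closed (+∈ d d′)    ws = ℰ-∂*-++ ws (ℰ-∂*-closed d ws) (ℰ-∂*-closed d′ ws)
    ℰ-∂*-closed (·∈ y d)     ws = resp (coeff-≈ (≋-sym (∂*-· ws y _))) (·∈ y (ℰ-∂*-closed d ws))
    ℰ-∂*-closed (E∈ p i k d) ws = ∂*-E-closed p i k ws (ℰ-∂*-closed d)

    ℰ-preserves-∂-closure : ∀ a b {f} → ℰ W f → ℰ W (∂ a b f)
    ℰ-preserves-∂-closure a b d = ℰ-∂*-closed d ((a , b) ∷ [])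

mainTheorem12 : ∀ {c ℓ v : Level} (K : Field c ℓ) → Char0 K → (l n : ℕ) →
    (V : Poly.R K l n → Set v) → Poly.IsHomogeneousSubspace K l n V →
    ∀ f → (Poly.ℰ K l n (Poly.𝒟 K l n V) f → Poly.𝒟 K l n (Poly.ℰ K l n V) f)
    × (Poly.𝒟 K l n (Poly.ℰ K l n V) f → Poly.ℰ K l n (Poly.𝒟 K l n V) f)
mainTheorem12 K _ l n V _ f = ℰ𝒟V⊆𝒟ℰV , 𝒟ℰV⊆ℰ𝒟V
  where
  open Poly K l n
  open Polarization K l n

  ℰ𝒟V⊆𝒟ℰV : ℰ (𝒟 V) ⊆ 𝒟 (ℰ V)
  ℰ𝒟V⊆𝒟ℰV = ℰ-minimal (𝒟-minimal (λ v → base (base v)) 𝒟-isSubspace ∂∈) 𝒟-isSubspace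
                       (𝒟-preserves-E-closure E∈)

  𝒟ℰV⊆ℰ𝒟V : 𝒟 (ℰ V) ⊆ ℰ (𝒟 V)
  𝒟ℰV⊆ℰ𝒟V = 𝒟-minimal (ℰ-minimal (λ v → base (base v)) ℰ-isSubspace E∈) ℰ-isSubspace
                       (ℰ-preserves-∂-closure ∂∈)
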